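{- For any integer $n\ge 2$, $\dim(P_n\boxtimes P_n)=3$.
   Context: $P_n$ is the path of order $n$. A set $S\subseteq V(G)$ of a connected graph $G$ is a metric generator if for every two distinct vertices $x,y$ there is $s\in S$ with $d_G(s,x)\ne d_G(s,y)$ (shortest-path distance); $\dim(G)$ is the minimum cardinality of a metric generator. The strong product $G\boxtimes H$ has vertex set $V(G)\times V(H)$, with $(a,b)$ and $(c,d)$ adjacent iff ($a=c$ and $bd\in E(H)$) or ($b=d$ and $ac\in E(G)$) or ($ac\in E(G)$ and $bd\in E(H)$). -}

module Defs where

open import Data.Nat using (ℕ; zero; suc; _+_; _≤_)
open import Data.Fin using (Fin; toℕ)
open import Data.Product using (_×_; Σ; ∃; _,_)
open import Data.Sum using (_⊎_)
open import Data.List using (List; length)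
open import Data.List.Membership.Propositional using (_∈_)
open import Data.List.Relation.Unary.Unique.Propositional using (Unique)
open import Relation.Binary.PropositionalEquality using (_≡_)
open import Relation.Nullary using (¬_)

record Graph : Set₁ where
  field
    V   : Set
    Adj : V → V → Set
open Graph public

data Walk (G : Graph) : V G → V G → ℕ → Set where
  [] : ∀ {u} → Walk G u u zero
  _∷_ : ∀ {u v w k} → Adj G u v → Walk G v w k → Walk G u w (suc k)

Dist : (G : Graph) → V G → V G → ℕ → Set
Dist G u v k = Walk G u v k × (∀ m → Walk G u v m → k ≤ m)

Connected : Graph → Set
Connected G = ∀ u v → ∃ λ k → Walk G u v k

Distinguishes : (G : Graph) → V G → V G → V G → Set
Distinguishes G s x y = ∀ k → Dist G s x k → ¬ Dist G s y k

IsMetricGenerator : (G : Graph) → List (V G) → Set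
IsMetricGenerator G S =
  ∀ x y → ¬ x ≡ y → ∃ λ s → s ∈ S × Distinguishes G s x y

MetricDim : Graph → ℕ → Set
MetricDim G k =
  (∃ λ S → Unique S × IsMetricGenerator G S × length S ≡ k)
  × (∀ S → Unique S → IsMetricGenerator G S → k ≤ length S)

Path : ℕ → Graph
Path n = record
  { V = Fin n
  ; Adj = λ i j → (suc (toℕ i) ≡ toℕ j) ⊎ (suc (toℕ j) ≡ toℕ i)
  }

_⊠_ : Graph → Graph → Graph
G ⊠ H = record
  { V = V G × V H
  ; Adj = λ { (a , b) (c , d) →
        (a ≡ c × Adj H b d) ⊎ ((b ≡ d × Adj G a c) ⊎ (Adj G a c × Adj H b d)) }
  }

-- The distance in P_n ⊠ P_n is max(|a - c|, |b - d|), the maximum of the path distances.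
-- Write N = n - 1. The corners (0,0) and (N,N) see max(x,y) and N - min(x,y), which fix {x,y};
-- the corner (0,N) sees max(x, N - y), which tells (x,y) from (y,x). Two vertices s, t never
-- resolve the grid: if s has a coordinate strictly between 0 and N, it has four neighbours at
-- distance 1 from s whose distances to t take at most the three values d(t,s) - 1, d(t,s),
-- d(t,s) + 1; if s and t are both corners, two vertices at distance N from both are found directly.
module Submission where

open import Defs
open import Data.Nat using (ℕ; zero; suc; _+_; _∸_; _⊔_; _⊓_; ∣_-_∣; _≤_; _<_; z≤n; s≤s)
open import Data.Nat.Properties
open import Data.Fin as Fin using (Fin; zero; suc; toℕ; fromℕ; fromℕ<; inject₁; remQuot; combine)
open import Data.Fin.Properties
  using ( pigeonhole; fromℕ<-injective; toℕ-injective; toℕ-fromℕ; toℕ-fromℕ<; toℕ-inject₁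
        ; toℕ≤pred[n]; combine-remQuot )
  renaming (_≟_ to _≟ᶠ_; <⇒≢ to <⇒≢ᶠ)
open import Function using (_∘_)
open import Data.Product using (_×_; _,_; proj₁; proj₂; ∃; ∃₂; uncurry; swap)
open import Data.Sum using (_⊎_; inj₁; inj₂)
import Data.Sum as Sum
open import Data.List using ([]; _∷_; length)
open import Data.List.Membership.Propositional using (_∈_; find)
open import Data.List.Relation.Unary.Any using (here; there; any?)
open import Data.List.Relation.Unary.All using (All; []; _∷_)
import Data.List.Relation.Unary.All as All
open import Data.List.Relation.Unary.All.Properties using (¬Any⇒All¬)
open import Data.List.Relation.Unary.AllPairs using ([]; _∷_)
open import Relation.Binary.PropositionalEquality
open import Relation.Binary.Definitions using (tri<; tri≈; tri>)
open import Relation.Nullary using (¬_; yes; no; contradiction)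
open import Relation.Nullary.Decidable using (¬?; decidable-stable)

private variable
  G H : Graph

module _ {G : Graph} where

  _∷ʳ_ : ∀ {u v w k} → Walk G u v k → Adj G v w → Walk G u w (suc k)
  [] ∷ʳ e = e ∷ []
  (f ∷ p) ∷ʳ e = f ∷ (p ∷ʳ e)

  reverse : (∀ {u v} → Adj G u v → Adj G v u) → ∀ {u v k} → Walk G u v k → Walk G v u k
  reverse adj-sym [] = []
  reverse adj-sym (e ∷ p) = reverse adj-sym p ∷ʳ adj-sym e

mapWalk : (f : V G → V H) → (∀ {u v} → Adj G u v → Adj H (f u) (f v)) →
          ∀ {u v k} → Walk G u v k → Walk H (f u) (f v) k
mapWalk f hom [] = []
mapWalk f hom (e ∷ p) = hom e ∷ mapWalk f hom p

module _ {G H : Graph} where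

  ⊠-walkˡ : ∀ {a c k} b → Walk G a c k → Walk (G ⊠ H) (a , b) (c , b) k
  ⊠-walkˡ b = mapWalk (_, b) (λ e → inj₂ (inj₁ (refl , e)))

  ⊠-walkʳ : ∀ a {b d k} → Walk H b d k → Walk (G ⊠ H) (a , b) (a , d) k
  ⊠-walkʳ a = mapWalk (a ,_) (λ e → inj₁ (refl , e))

  ⊠-walk : ∀ {a b c d k l} → Walk G a c k → Walk H b d l → Walk (G ⊠ H) (a , b) (c , d) (k ⊔ l)
  ⊠-walk {a = a} [] q = ⊠-walkʳ a q
  ⊠-walk {b = b} (e ∷ p) [] = ⊠-walkˡ b (e ∷ p)
  ⊠-walk (e ∷ p) (f ∷ q) = inj₂ (inj₂ (e , f)) ∷ ⊠-walk p q

-- Such a ρ is the graph distance: ρ-adj and ρ-triangle bound it by the length of any walk,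
-- and geodesic attains the bound.
record GraphMetric (G : Graph) : Set where
  field
    ρ          : V G → V G → ℕ
    ρ-refl     : ∀ u → ρ u u ≡ 0
    ρ-sym      : ∀ u v → ρ u v ≡ ρ v u
    ρ-triangle : ∀ u v w → ρ u w ≤ ρ u v + ρ v w
    ρ-adj      : ∀ {u v} → Adj G u v → ρ u v ≤ 1
    geodesic   : ∀ u v → Walk G u v (ρ u v)

m<n+o⇒m∸o<n : ∀ {m} n o → m < n + o → o ≤ m → m ∸ o < n
m<n+o⇒m∸o<n {m} n o m<n+o o≤m = subst (m ∸ o <_) (m+n∸n≡m n o) (∸-monoˡ-< m<n+o o≤m)

pigeonhole-window : ∀ {n} w L → w < n → (f : Fin n → ℕ) →
                    (∀ i → L ≤ f i) → (∀ i → f i < w + L) → ∃₂ λ i j → i ≢ j × f i ≡ f j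
pigeonhole-window w L w<n f L≤f f<w+L = collision (pigeonhole w<n (λ i → fromℕ< (offset<w i)))
  where
  offset<w : ∀ i → f i ∸ L < w
  offset<w i = m<n+o⇒m∸o<n w L (f<w+L i) (L≤f i)

  collision : (∃₂ λ i j → i Fin.< j × fromℕ< (offset<w i) ≡ fromℕ< (offset<w j)) →
              ∃₂ λ i j → i ≢ j × f i ≡ f j
  collision (i , j , i<j , offsetᵢ≡offsetⱼ) =
    i , j , <⇒≢ᶠ i<j ,
    ∸-cancelʳ-≡ (L≤f i) (L≤f j) (fromℕ<-injective _ _ (offset<w i) (offset<w j) offsetᵢ≡offsetⱼ)

module _ {G : Graph} (M : GraphMetric G) where
  open GraphMetric M

  ρ≤length : ∀ {u v m} → Walk G u v m → ρ u v ≤ m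
  ρ≤length {u} [] = ≤-reflexive (ρ-refl u)
  ρ≤length {u} {w} (_∷_ {v = v} e p) = ≤-trans (ρ-triangle u v w) (+-mono-≤ (ρ-adj e) (ρ≤length p))

  dist-ρ : ∀ u v → Dist G u v (ρ u v)
  dist-ρ u v = geodesic u v , λ _ → ρ≤length

  dist⇒≡ρ : ∀ {u v k} → Dist G u v k → k ≡ ρ u v
  dist⇒≡ρ {u} {v} (p , minimal) = ≤-antisym (minimal _ (geodesic u v)) (ρ≤length p)

  distinguishes⇒ρ≢ : ∀ {s x y} → Distinguishes G s x y → ρ s x ≢ ρ s y
  distinguishes⇒ρ≢ {s} {x} {y} d ρx≡ρy =
    d (ρ s x) (dist-ρ s x) (subst (Dist G s y) (sym ρx≡ρy) (dist-ρ s y))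

  ρ≢⇒distinguishes : ∀ {s x y} → ρ s x ≢ ρ s y → Distinguishes G s x y
  ρ≢⇒distinguishes ρx≢ρy k p q = ρx≢ρy (trans (sym (dist⇒≡ρ p)) (dist⇒≡ρ q))

  generator-if-ρ-injective : ∀ S → (∀ x y → All (λ s → ρ s x ≡ ρ s y) S → x ≡ y) → IsMetricGenerator G S
  generator-if-ρ-injective S injective x y x≢y with any? (λ s → ¬? (ρ s x ≟ ρ s y)) S
  ... | yes some = let s , s∈S , ρx≢ρy = find some in s , s∈S , ρ≢⇒distinguishes ρx≢ρy
  ... | no none = contradiction (injective x y (All.map (decidable-stable (_ ≟ _)) (¬Any⇒All¬ S none))) x≢y

  UnresolvedPair : V G → V G → Set
  UnresolvedPair s t = ∃₂ λ x y → x ≢ y × ρ s x ≡ ρ s y × ρ t x ≡ ρ t y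

  unresolved-sym : ∀ {s t} → UnresolvedPair s t → UnresolvedPair t s
  unresolved-sym (x , y , x≢y , eₛ , eₜ) = x , y , x≢y , eₜ , eₛ

  ¬generator : ∀ {s t S} → UnresolvedPair s t → (∀ {r} → r ∈ S → r ≡ s ⊎ r ≡ t) → ¬ IsMetricGenerator G S
  ¬generator (x , y , x≢y , eₛ , eₜ) S⊆st generator with generator x y x≢y
  ... | r , r∈S , d with S⊆st r∈S
  ...   | inj₁ refl = distinguishes⇒ρ≢ d eₛ
  ...   | inj₂ refl = distinguishes⇒ρ≢ d eₜ

  3≤generator-length : V G → (∀ s t → UnresolvedPair s t) → ∀ S → IsMetricGenerator G S → 3 ≤ length S
  3≤generator-length v unresolved [] generator =
    contradiction generator (¬generator (unresolved v v) λ ())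
  3≤generator-length v unresolved (s ∷ []) generator =
    contradiction generator (¬generator (unresolved s s) λ { (here e) → inj₁ e })
  3≤generator-length v unresolved (s ∷ t ∷ []) generator =
    contradiction generator (¬generator (unresolved s t) λ { (here e) → inj₁ e ; (there (here e)) → inj₂ e })
  3≤generator-length v unresolved (_ ∷ _ ∷ _ ∷ _) _ = s≤s (s≤s (s≤s z≤n))

  -- The window {ρ t s - 1, ρ t s, ρ t s + 1} is shifted by one to avoid truncated subtraction.
  four-neighbours-unresolved : ∀ {s} (p : Fin 4 → V G) → (∀ i j → p i ≡ p j → i ≡ j) →
                               (∀ i → ρ s (p i) ≡ 1) → ∀ t → UnresolvedPair s t
  four-neighbours-unresolved {s} p p-injective ρ≡1 t =
    collision (pigeonhole-window 3 (ρ t s) (s≤s (s≤s (s≤s (s≤s z≤n)))) (λ i → suc (ρ t (p i))) lower upper)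
    where
    collision : (∃₂ λ i j → i ≢ j × suc (ρ t (p i)) ≡ suc (ρ t (p j))) → UnresolvedPair s t
    collision (i , j , i≢j , eq) =
      p i , p j , (λ pᵢ≡pⱼ → i≢j (p-injective i j pᵢ≡pⱼ)) , trans (ρ≡1 i) (sym (ρ≡1 j)) , suc-injective eq
    lower : ∀ i → ρ t s ≤ suc (ρ t (p i))
    lower i = begin
      ρ t s                   ≤⟨ ρ-triangle t (p i) s ⟩
      ρ t (p i) + ρ (p i) s   ≡⟨ cong (ρ t (p i) +_) (trans (ρ-sym (p i) s) (ρ≡1 i)) ⟩
      ρ t (p i) + 1           ≡⟨ +-comm (ρ t (p i)) 1 ⟩
      suc (ρ t (p i))         ∎
      where open ≤-Reasoning
    upper : ∀ i → suc (ρ t (p i)) < 3 + ρ t s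
    upper i = s≤s (s≤s (begin
      ρ t (p i)               ≤⟨ ρ-triangle t s (p i) ⟩
      ρ t s + ρ s (p i)       ≡⟨ cong (ρ t s +_) (ρ≡1 i) ⟩
      ρ t s + 1               ≡⟨ +-comm (ρ t s) 1 ⟩
      suc (ρ t s)             ∎))
      where open ≤-Reasoning

⊔-triangle : ∀ {x y} a b c d → x ≤ a + b → y ≤ c + d → x ⊔ y ≤ (a ⊔ c) + (b ⊔ d)
⊔-triangle a b c d x≤a+b y≤c+d =
  ⊔-lub (≤-trans x≤a+b (+-mono-≤ (m≤m⊔n a c) (m≤m⊔n b d)))
        (≤-trans y≤c+d (+-mono-≤ (m≤n⊔m a c) (m≤n⊔m b d)))

_⊠ᵐ_ : GraphMetric G → GraphMetric H → GraphMetric (G ⊠ H)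
_⊠ᵐ_ {G} {H} M N = record
  { ρ          = λ { (a , b) (c , d) → M.ρ a c ⊔ N.ρ b d }
  ; ρ-refl     = λ { (a , b) → cong₂ _⊔_ (M.ρ-refl a) (N.ρ-refl b) }
  ; ρ-sym      = λ { (a , b) (c , d) → cong₂ _⊔_ (M.ρ-sym a c) (N.ρ-sym b d) }
  ; ρ-triangle = λ { (a , b) (c , d) (e , f) →
                   ⊔-triangle (M.ρ a c) (M.ρ c e) (N.ρ b d) (N.ρ d f)
                              (M.ρ-triangle a c e) (N.ρ-triangle b d f) }
  ; ρ-adj      = adj
  ; geodesic   = λ { (a , b) (c , d) → ⊠-walk (M.geodesic a c) (N.geodesic b d) }
  }
  where
  module M = GraphMetric M
  module N = GraphMetric N

  adj : ∀ {u v} → Adj (G ⊠ H) u v → M.ρ (proj₁ u) (proj₁ v) ⊔ N.ρ (proj₂ u) (proj₂ v) ≤ 1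
  adj {a , _} (inj₁ (refl , e)) = ⊔-lub (≤-trans (≤-reflexive (M.ρ-refl a)) z≤n) (N.ρ-adj e)
  adj {_ , b} (inj₂ (inj₁ (refl , e))) = ⊔-lub (M.ρ-adj e) (≤-trans (≤-reflexive (N.ρ-refl b)) z≤n)
  adj (inj₂ (inj₂ (e , f))) = ⊔-lub (M.ρ-adj e) (N.ρ-adj f)

∣m-1+m∣≡1 : ∀ m → ∣ m - suc m ∣ ≡ 1
∣m-1+m∣≡1 zero = refl
∣m-1+m∣≡1 (suc m) = ∣m-1+m∣≡1 m

path-adj⇒∣-∣≡1 : ∀ {n} {i j : Fin n} → Adj (Path n) i j → ∣ toℕ i - toℕ j ∣ ≡ 1
path-adj⇒∣-∣≡1 {i = i} (inj₁ 1+i≡j) = subst (λ k → ∣ toℕ i - k ∣ ≡ 1) 1+i≡j (∣m-1+m∣≡1 (toℕ i))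
path-adj⇒∣-∣≡1 {j = j} (inj₂ 1+j≡i) =
  subst (λ k → ∣ k - toℕ j ∣ ≡ 1) 1+j≡i (trans (∣-∣-comm (suc (toℕ j)) (toℕ j)) (∣m-1+m∣≡1 (toℕ j)))

suc-adj : ∀ {n} {i j : Fin n} → Adj (Path n) i j → Adj (Path (suc n)) (suc i) (suc j)
suc-adj = Sum.map (cong suc) (cong suc)

walk-from-zero : ∀ {n} (j : Fin (suc n)) → Walk (Path (suc n)) zero j (toℕ j)
walk-from-zero zero = []
walk-from-zero {suc n} (suc j) = inj₁ refl ∷ mapWalk suc suc-adj (walk-from-zero j)

path-geodesic : ∀ {n} (i j : Fin n) → Walk (Path n) i j ∣ toℕ i - toℕ j ∣
path-geodesic zero j = walk-from-zero j
path-geodesic (suc i) zero = reverse Sum.swap (walk-from-zero (suc i))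
path-geodesic (suc i) (suc j) = mapWalk suc suc-adj (path-geodesic i j)

pathMetric : ∀ n → GraphMetric (Path n)
pathMetric n = record
  { ρ          = λ i j → ∣ toℕ i - toℕ j ∣
  ; ρ-refl     = λ i → ∣n-n∣≡0 (toℕ i)
  ; ρ-sym      = λ i j → ∣-∣-comm (toℕ i) (toℕ j)
  ; ρ-triangle = λ i j k → ∣-∣-triangle (toℕ i) (toℕ j) (toℕ k)
  ; ρ-adj      = λ e → ≤-reflexive (path-adj⇒∣-∣≡1 e)
  ; geodesic   = path-geodesic
  }

module _ {G : Graph} (M : GraphMetric G) where
  open GraphMetric (M ⊠ᵐ M)

  ρ-swap : ∀ u v → ρ (swap u) (swap v) ≡ ρ u v
  ρ-swap (a , b) (c , d) = ⊔-comm (GraphMetric.ρ M b d) (GraphMetric.ρ M a c)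

  unresolved-swap : ∀ {s t} → UnresolvedPair (M ⊠ᵐ M) s t → UnresolvedPair (M ⊠ᵐ M) (swap s) (swap t)
  unresolved-swap {s} {t} (x , y , x≢y , eₛ , eₜ) =
    swap x , swap y , (λ e → x≢y (cong swap e)) ,
    trans (ρ-swap s x) (trans eₛ (sym (ρ-swap s y))) ,
    trans (ρ-swap t x) (trans eₜ (sym (ρ-swap t y)))

pick : {A : Set} → A → A → Fin 2 → A
pick x y zero = x
pick x y (suc _) = y

pick-injective : ∀ {A : Set} {x y : A} → x ≢ y → ∀ k l → pick x y k ≡ pick x y l → k ≡ l
pick-injective x≢y zero zero _ = refl
pick-injective x≢y zero (suc zero) x≡y = contradiction x≡y x≢y
pick-injective x≢y (suc zero) zero y≡x = contradiction (sym y≡x) x≢y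
pick-injective x≢y (suc zero) (suc zero) _ = refl

module _ {G H : Graph} (M : GraphMetric G) (N : GraphMetric H) where
  private
    module M = GraphMetric M
    module N = GraphMetric N

  ⊠-four-neighbours-unresolved : ∀ {a a₋ a₊ b b′} → M.ρ a a₋ ≡ 1 → M.ρ a a₊ ≡ 1 → a₋ ≢ a₊ → N.ρ b b′ ≡ 1 →
                                 ∀ t → UnresolvedPair (M ⊠ᵐ N) (a , b) t
  ⊠-four-neighbours-unresolved {a} {a₋} {a₊} {b} {b′} ρa₋≡1 ρa₊≡1 a₋≢a₊ ρb′≡1 =
    four-neighbours-unresolved (M ⊠ᵐ N) point point-injective ρ≡1
    where
    b≢b′ : b ≢ b′
    b≢b′ refl = contradiction (trans (sym (N.ρ-refl b)) ρb′≡1) λ ()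

    point : Fin 4 → V G × V H
    point i = pick a₋ a₊ (proj₁ (remQuot {2} 2 i)) , pick b b′ (proj₂ (remQuot {2} 2 i))

    point-injective : ∀ i j → point i ≡ point j → i ≡ j
    point-injective i j eq = begin
      i                                 ≡⟨ combine-remQuot {2} 2 i ⟨
      uncurry combine (remQuot {2} 2 i) ≡⟨ cong (uncurry combine) remQuot≡ ⟩
      uncurry combine (remQuot {2} 2 j) ≡⟨ combine-remQuot {2} 2 j ⟩
      j                                 ∎
      where
      open ≡-Reasoning
      remQuot≡ : remQuot {2} 2 i ≡ remQuot {2} 2 j
      remQuot≡ = cong₂ _,_ (pick-injective a₋≢a₊ _ _ (cong proj₁ eq))
                           (pick-injective b≢b′ _ _ (cong proj₂ eq))

    ρ₁≡1 : ∀ k → M.ρ a (pick a₋ a₊ k) ≡ 1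
    ρ₁≡1 zero = ρa₋≡1
    ρ₁≡1 (suc zero) = ρa₊≡1

    ρ₂≤1 : ∀ l → N.ρ b (pick b b′ l) ≤ 1
    ρ₂≤1 zero = ≤-trans (≤-reflexive (N.ρ-refl b)) z≤n
    ρ₂≤1 (suc zero) = ≤-reflexive ρb′≡1

    ρ≡1 : ∀ i → GraphMetric.ρ (M ⊠ᵐ N) (a , b) (point i) ≡ 1
    ρ≡1 i = trans (cong (_⊔ N.ρ b (proj₂ (point i))) (ρ₁≡1 (proj₁ (remQuot {2} 2 i))))
                  (m≥n⇒m⊔n≡m (ρ₂≤1 (proj₂ (remQuot {2} 2 i))))

⊓-⊔-sorted-determine : ∀ {x y x′ y′} → x ≤ y → x ⊓ y ≡ x′ ⊓ y′ → x ⊔ y ≡ x′ ⊔ y′ →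
                       (x ≡ x′ × y ≡ y′) ⊎ (x ≡ y′ × y ≡ x′)
⊓-⊔-sorted-determine {x} {y} {x′} {y′} x≤y min≡ max≡ with ≤-total x′ y′
... | inj₁ x′≤y′ = inj₁ ( trans (sym (m≤n⇒m⊓n≡m x≤y)) (trans min≡ (m≤n⇒m⊓n≡m x′≤y′))
                        , trans (sym (m≤n⇒m⊔n≡n x≤y)) (trans max≡ (m≤n⇒m⊔n≡n x′≤y′)))
... | inj₂ y′≤x′ = inj₂ ( trans (sym (m≤n⇒m⊓n≡m x≤y)) (trans min≡ (m≥n⇒m⊓n≡n y′≤x′))
                        , trans (sym (m≤n⇒m⊔n≡n x≤y)) (trans max≡ (m≥n⇒m⊔n≡m y′≤x′)))

⊓-⊔-determine : ∀ x y x′ y′ → x ⊓ y ≡ x′ ⊓ y′ → x ⊔ y ≡ x′ ⊔ y′ → (x ≡ x′ × y ≡ y′) ⊎ (x ≡ y′ × y ≡ x′)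
⊓-⊔-determine x y x′ y′ min≡ max≡ with ≤-total x y
... | inj₁ x≤y = ⊓-⊔-sorted-determine x≤y min≡ max≡
... | inj₂ y≤x = Sum.swap (Sum.map swap swap
      (⊓-⊔-sorted-determine y≤x (trans (⊓-comm y x) min≡) (trans (⊔-comm y x) max≡)))

⊔-∸-strict : ∀ {N y y′} → y < y′ → y′ ≤ N → y ⊔ (N ∸ y′) < y′ ⊔ (N ∸ y)
⊔-∸-strict {N} {y} {y′} y<y′ y′≤N =
  ⊔-lub (<-≤-trans y<y′ (m≤m⊔n y′ (N ∸ y))) (<-≤-trans (∸-monoʳ-< y<y′ y′≤N) (m≤n⊔m y′ (N ∸ y)))

⊔-∸-injective : ∀ {N y y′} → y ≤ N → y′ ≤ N → y′ ⊔ (N ∸ y) ≡ y ⊔ (N ∸ y′) → y ≡ y′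
⊔-∸-injective {y = y} {y′} y≤N y′≤N eq with <-cmp y y′
... | tri< y<y′ _ _ = contradiction (sym eq) (<⇒≢ (⊔-∸-strict y<y′ y′≤N))
... | tri≈ _ y≡y′ _ = y≡y′
... | tri> _ _ y′<y = contradiction eq (<⇒≢ (⊔-∸-strict y′<y y≤N))

corner-distances-injective : ∀ {N x y x′ y′} → x ≤ N → y ≤ N → x′ ≤ N → y′ ≤ N →
  x ⊔ y ≡ x′ ⊔ y′ → N ∸ (x ⊓ y) ≡ N ∸ (x′ ⊓ y′) → x ⊔ (N ∸ y) ≡ x′ ⊔ (N ∸ y′) → x ≡ x′ × y ≡ y′
corner-distances-injective {N} {x} {y} {x′} {y′} x≤N y≤N x′≤N y′≤N max≡ N∸min≡ third≡
  with ⊓-⊔-determine x y x′ y′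
         (∸-cancelˡ-≡ (≤-trans (m⊓n≤m x y) x≤N) (≤-trans (m⊓n≤m x′ y′) x′≤N) N∸min≡) max≡
... | inj₁ same = same
... | inj₂ (x≡y′ , y≡x′) = trans x≡y′ (trans (sym y≡y′) y≡x′) , y≡y′
  where
  y≡y′ : y ≡ y′
  y≡y′ = ⊔-∸-injective y≤N y′≤N
    (trans (cong (_⊔ (N ∸ y)) (sym x≡y′)) (trans third≡ (cong (_⊔ (N ∸ y′)) (sym y≡x′))))

gridMetric : ∀ n → GraphMetric (Path n ⊠ Path n)
gridMetric n = pathMetric n ⊠ᵐ pathMetric n

module _ {N : ℕ} where
  open GraphMetric (gridMetric (suc N))

  corner₀₀ cornerₙₙ corner₀ₙ : Fin (suc N) × Fin (suc N)
  corner₀₀ = zero , zero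
  cornerₙₙ = fromℕ N , fromℕ N
  corner₀ₙ = zero , fromℕ N

  ∣N-i∣≡N∸i : (i : Fin (suc N)) → ∣ toℕ (fromℕ N) - toℕ i ∣ ≡ N ∸ toℕ i
  ∣N-i∣≡N∸i i rewrite toℕ-fromℕ N = m≤n⇒∣n-m∣≡n∸m (toℕ≤pred[n] i)

  ρ-cornerₙₙ : ∀ a b → ρ cornerₙₙ (a , b) ≡ N ∸ (toℕ a ⊓ toℕ b)
  ρ-cornerₙₙ a b = trans (cong₂ _⊔_ (∣N-i∣≡N∸i a) (∣N-i∣≡N∸i b)) (sym (∸-distribˡ-⊓-⊔ N (toℕ a) (toℕ b)))

  ρ-corner₀ₙ : ∀ a b → ρ corner₀ₙ (a , b) ≡ toℕ a ⊔ (N ∸ toℕ b)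
  ρ-corner₀ₙ a b = cong (toℕ a ⊔_) (∣N-i∣≡N∸i b)

  corners-resolve : ∀ x y → All (λ s → ρ s x ≡ ρ s y) (corner₀₀ ∷ cornerₙₙ ∷ corner₀ₙ ∷ []) → x ≡ y
  corners-resolve (a , b) (c , d) (e₀₀ ∷ eₙₙ ∷ e₀ₙ ∷ [])
    with a≡c , b≡d ← corner-distances-injective (toℕ≤pred[n] a) (toℕ≤pred[n] b) (toℕ≤pred[n] c) (toℕ≤pred[n] d)
                       e₀₀ (trans (sym (ρ-cornerₙₙ a b)) (trans eₙₙ (ρ-cornerₙₙ c d)))
                           (trans (sym (ρ-corner₀ₙ a b)) (trans e₀ₙ (ρ-corner₀ₙ c d)))
    = cong₂ _,_ (toℕ-injective a≡c) (toℕ-injective b≡d)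

module _ {N : ℕ} where
  open GraphMetric (gridMetric (suc N))

  Extreme Interior : Fin (suc N) → Set
  Extreme a = toℕ a ≡ 0 ⊎ toℕ a ≡ N
  Interior a = 0 < toℕ a × toℕ a < N

  extreme-or-interior : (a : Fin (suc N)) → Extreme a ⊎ Interior a
  extreme-or-interior a with toℕ a ≟ 0 | toℕ a ≟ N
  ... | yes a≡0 | _ = inj₁ (inj₁ a≡0)
  ... | no _ | yes a≡N = inj₁ (inj₂ a≡N)
  ... | no a≢0 | no a≢N = inj₂ (n≢0⇒n>0 a≢0 , ≤∧≢⇒< (toℕ≤pred[n] a) a≢N)

  corner-or-interior : (a b : Fin (suc N)) → (Extreme a × Extreme b) ⊎ (Interior a ⊎ Interior b)
  corner-or-interior a b with extreme-or-interior a | extreme-or-interior b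
  ... | inj₁ extremeᵃ | inj₁ extremeᵇ = inj₁ (extremeᵃ , extremeᵇ)
  ... | inj₁ _ | inj₂ interiorᵇ = inj₂ (inj₂ interiorᵇ)
  ... | inj₂ interiorᵃ | _ = inj₂ (inj₁ interiorᵃ)

  opposite-extreme : (b : Fin (suc N)) → Extreme b → ∃ λ q → ∣ toℕ b - toℕ q ∣ ≡ N
  opposite-extreme b (inj₁ b≡0) = fromℕ N , cong₂ ∣_-_∣ b≡0 (toℕ-fromℕ N)
  opposite-extreme b (inj₂ b≡N) = zero , trans (cong ∣_- 0 ∣ b≡N) (∣-∣-identityʳ N)

  extremes-apart : ∀ {a c : Fin (suc N)} → Extreme a → Extreme c → a ≢ c → ∣ toℕ a - toℕ c ∣ ≡ N
  extremes-apart (inj₁ a≡0) (inj₁ c≡0) a≢c = contradiction (toℕ-injective (trans a≡0 (sym c≡0))) a≢c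
  extremes-apart (inj₁ a≡0) (inj₂ c≡N) _ = cong₂ ∣_-_∣ a≡0 c≡N
  extremes-apart (inj₂ a≡N) (inj₁ c≡0) _ = trans (cong₂ ∣_-_∣ a≡N c≡0) (∣-∣-identityʳ N)
  extremes-apart (inj₂ a≡N) (inj₂ c≡N) a≢c = contradiction (toℕ-injective (trans a≡N (sym c≡N))) a≢c

  ∣-∣≤N : (a c : Fin (suc N)) → ∣ toℕ a - toℕ c ∣ ≤ N
  ∣-∣≤N a c = ≤-trans (∣m-n∣≤m⊔n (toℕ a) (toℕ c)) (⊔-lub (toℕ≤pred[n] a) (toℕ≤pred[n] c))

  ρ-row-apart : ∀ a b c d → ∣ toℕ b - toℕ d ∣ ≡ N → ρ (a , b) (c , d) ≡ N
  ρ-row-apart a b c d b-d≡N = trans (cong (∣ toℕ a - toℕ c ∣ ⊔_) b-d≡N) (m≤n⇒m⊔n≡n (∣-∣≤N a c))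

  ρ-column-apart : ∀ a b c d → ∣ toℕ a - toℕ c ∣ ≡ N → ρ (a , b) (c , d) ≡ N
  ρ-column-apart a b c d a-c≡N = trans (cong (_⊔ ∣ toℕ b - toℕ d ∣) a-c≡N) (m≥n⇒m⊔n≡m (∣-∣≤N b d))

module _ {m : ℕ} where

  Unresolved : (s t : Fin (suc (suc m)) × Fin (suc (suc m))) → Set
  Unresolved = UnresolvedPair (gridMetric (suc (suc m)))

  interior-neighbours : (a : Fin (suc (suc m))) → Interior a →
                        ∃₂ λ a₋ a₊ → Adj (Path _) a a₋ × Adj (Path _) a a₊ × a₋ ≢ a₊
  interior-neighbours zero (() , _)
  interior-neighbours (suc c) (_ , a<N) =
    inject₁ c , fromℕ< (s≤s a<N) , inj₂ (cong suc (toℕ-inject₁ c)) , inj₁ (sym (toℕ-fromℕ< (s≤s a<N))) , a₋≢a₊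
    where
    a₋≢a₊ : inject₁ c ≢ fromℕ< (s≤s a<N)
    a₋≢a₊ e = <⇒≢ (m<n⇒m<1+n (n<1+n (toℕ c)))
                  (trans (sym (toℕ-inject₁ c)) (trans (cong toℕ e) (toℕ-fromℕ< (s≤s a<N))))

  some-neighbour : (b : Fin (suc (suc m))) → ∃ λ b′ → Adj (Path _) b b′
  some-neighbour zero = suc zero , inj₁ refl
  some-neighbour (suc c) = inject₁ c , inj₂ (cong suc (toℕ-inject₁ c))

  interior-unresolved : ∀ a b → Interior a ⊎ Interior b → ∀ t → Unresolved (a , b) t
  interior-unresolved a b (inj₁ interiorᵃ) t
    with a₋ , a₊ , a~a₋ , a~a₊ , a₋≢a₊ ← interior-neighbours a interiorᵃ
       | b′ , b~b′ ← some-neighbour b =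
    ⊠-four-neighbours-unresolved (pathMetric _) (pathMetric _) {a} {a₋} {a₊} {b} {b′}
      (path-adj⇒∣-∣≡1 a~a₋) (path-adj⇒∣-∣≡1 a~a₊) a₋≢a₊ (path-adj⇒∣-∣≡1 b~b′) t
  interior-unresolved a b (inj₂ interiorᵇ) t =
    unresolved-swap (pathMetric _) {b , a} {swap t} (interior-unresolved b a (inj₁ interiorᵇ) (swap t))

  shared-extreme-row-unresolved : ∀ a₁ a₂ b → Extreme b → Unresolved (a₁ , b) (a₂ , b)
  shared-extreme-row-unresolved a₁ a₂ b extremeᵇ with q , b-q≡N ← opposite-extreme b extremeᵇ =
    (zero , q) , (suc zero , q) , (λ ()) ,
    trans (ρ-row-apart a₁ b zero q b-q≡N) (sym (ρ-row-apart a₁ b (suc zero) q b-q≡N)) ,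
    trans (ρ-row-apart a₂ b zero q b-q≡N) (sym (ρ-row-apart a₂ b (suc zero) q b-q≡N))

  opposite-corners-unresolved : ∀ {a₁ b₁ a₂ b₂} → Extreme a₁ → Extreme b₁ → Extreme a₂ → Extreme b₂ →
                                a₁ ≢ a₂ → b₁ ≢ b₂ → Unresolved (a₁ , b₁) (a₂ , b₂)
  opposite-corners-unresolved {a₁} {b₁} {a₂} {b₂} ea₁ eb₁ ea₂ eb₂ a₁≢a₂ b₁≢b₂ =
    (a₁ , b₂) , (a₂ , b₁) , (λ e → a₁≢a₂ (cong proj₁ e)) ,
    trans (ρ-row-apart a₁ b₁ a₁ b₂ (extremes-apart eb₁ eb₂ b₁≢b₂))
          (sym (ρ-column-apart a₁ b₁ a₂ b₁ (extremes-apart ea₁ ea₂ a₁≢a₂))) ,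
    trans (ρ-column-apart a₂ b₂ a₁ b₂ (extremes-apart ea₂ ea₁ (a₁≢a₂ ∘ sym)))
          (sym (ρ-row-apart a₂ b₂ a₂ b₁ (extremes-apart eb₂ eb₁ (b₁≢b₂ ∘ sym))))

  corners-unresolved : ∀ {a₁ b₁ a₂ b₂} → Extreme a₁ → Extreme b₁ → Extreme a₂ → Extreme b₂ →
                       Unresolved (a₁ , b₁) (a₂ , b₂)
  corners-unresolved {a₁} {b₁} {a₂} {b₂} ea₁ eb₁ ea₂ eb₂ with b₁ ≟ᶠ b₂ | a₁ ≟ᶠ a₂
  ... | yes refl | _ = shared-extreme-row-unresolved a₁ a₂ b₁ eb₁
  ... | no _ | yes refl =
    unresolved-swap (pathMetric _) {b₁ , a₁} {b₂ , a₁} (shared-extreme-row-unresolved b₁ b₂ a₁ ea₁)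
  ... | no b₁≢b₂ | no a₁≢a₂ = opposite-corners-unresolved ea₁ eb₁ ea₂ eb₂ a₁≢a₂ b₁≢b₂

  grid-unresolved : ∀ s t → Unresolved s t
  grid-unresolved (a₁ , b₁) (a₂ , b₂) with corner-or-interior a₁ b₁ | corner-or-interior a₂ b₂
  ... | inj₂ interior₁ | _ = interior-unresolved a₁ b₁ interior₁ (a₂ , b₂)
  ... | inj₁ _ | inj₂ interior₂ =
    unresolved-sym (gridMetric _) {a₂ , b₂} {a₁ , b₁} (interior-unresolved a₂ b₂ interior₂ (a₁ , b₁))
  ... | inj₁ (ea₁ , eb₁) | inj₁ (ea₂ , eb₂) = corners-unresolved ea₁ eb₁ ea₂ eb₂

theorem6 : ∀ (n : ℕ) → 2 ≤ n → MetricDim (Path n ⊠ Path n) 3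
theorem6 (suc (suc m)) (s≤s (s≤s z≤n)) =
  ( (corner₀₀ ∷ cornerₙₙ ∷ corner₀ₙ ∷ [])
  , ((λ ()) ∷ (λ ()) ∷ []) ∷ ((λ ()) ∷ []) ∷ [] ∷ []
  , generator-if-ρ-injective (gridMetric _) _ corners-resolve
  , refl )
  , λ S _ → 3≤generator-length (gridMetric _) (zero , zero) grid-unresolved S
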